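{- There exists a structure in a relational first-order language which is elementarily indivisible, not transitive, and not homogeneous.
   Context: A structure $\mathcal{M}$ is elementarily indivisible if for every coloring of its universe $M$ in two colors there is a monochromatic substructure $\mathcal{M}'\subseteq\mathcal{M}$ with $\mathcal{M}'\cong\mathcal{M}$ and $\mathcal{M}'\preceq\mathcal{M}$. $\mathcal{M}$ is transitive if for every $a,b\in M$ there is $\sigma\in\mathrm{Aut}(\mathcal{M})$ with $\sigma(a)=b$. $\mathcal{M}$ is homogeneous if whenever $A\subset M$ with $|A|<|M|$ and $f:A\to M$ is a partial elementary map (i.e. $\mathcal{M}\models\varphi(\bar b)\iff\mathcal{M}\models\varphi(f(\bar b))$ for all formulas $\varphi$ and finite tuples $\bar b$ from $A$), there is $\sigma\in\mathrm{Aut}(\mathcal{M})$ with $\sigma\upharpoonright A=f$. -}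

module Defs where


open import Data.Nat using (ℕ; suc)
open import Data.Fin using (Fin)
open import Data.Bool using (Bool; T)
open import Data.Empty using (⊥)
open import Data.Product using (Σ; _×_; _,_; proj₁)
open import Data.Vec.Functional using (_∷_)
open import Function using (_∘_)
open import Function.Bundles using (_⇔_)
open import Function.Definitions using (Injective)
open import Relation.Binary.PropositionalEquality using (_≡_)
open import Relation.Nullary using (¬_)

record Language : Set₁ where
  field
    Sym   : Set
    arity : Sym → ℕ
open Language public

record Structure (L : Language) : Set₁ where
  field
    Carrier : Set
    rel     : (R : Sym L) → (Fin (arity L R) → Carrier) → Set
open Structure public

-- First-order formulas with (de Bruijn) free variables among Fin n.
-- Classical basis: atomic, equality, falsum, implication, universal quantifier.
data Formula (L : Language) (n : ℕ) : Set where
  atom : (R : Sym L) → (Fin (arity L R) → Fin n) → Formula L n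
  eq   : Fin n → Fin n → Formula L n
  ff   : Formula L n
  _⇒_  : Formula L n → Formula L n → Formula L n
  all  : Formula L (suc n) → Formula L n

_⊨_[_] : {L : Language} {n : ℕ} (M : Structure L) → Formula L n →
         (Fin n → Carrier M) → Set
M ⊨ atom R f [ v ] = rel M R (v ∘ f)
M ⊨ eq i j   [ v ] = v i ≡ v j
M ⊨ ff       [ v ] = ⊥
M ⊨ (φ ⇒ ψ)  [ v ] = M ⊨ φ [ v ] → M ⊨ ψ [ v ]
M ⊨ all φ    [ v ] = (a : Carrier M) → M ⊨ φ [ a ∷ v ]

Subset : Set → Set
Subset A = A → Bool

Elts : {A : Set} → Subset A → Set
Elts {A} S = Σ A (λ a → T (S a))

Induced : {L : Language} (M : Structure L) → Subset (Carrier M) → Structure L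
Induced M S = record { Carrier = Elts S ; rel = λ R v → rel M R (proj₁ ∘ v) }

IsElementarySub : {L : Language} (M : Structure L) → Subset (Carrier M) → Set
IsElementarySub M S =
  ∀ (n : ℕ) (φ : Formula _ n) (v : Fin n → Elts S) →
    (Induced M S ⊨ φ [ v ]) ⇔ (M ⊨ φ [ proj₁ ∘ v ])

record _≅_ {L : Language} (M N : Structure L) : Set where
  field
    to        : Carrier M → Carrier N
    from      : Carrier N → Carrier M
    from∘to   : ∀ x → from (to x) ≡ x
    to∘from   : ∀ y → to (from y) ≡ y
    preserves : ∀ (R : Sym L) (v : Fin (arity L R) → Carrier M) →
                rel M R v ⇔ rel N R (to ∘ v)
open _≅_ public

Aut : {L : Language} → Structure L → Set
Aut M = M ≅ M

ElementarilyIndivisible : {L : Language} → Structure L → Set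
ElementarilyIndivisible M =
  ∀ (c : Carrier M → Bool) →
    Σ (Subset (Carrier M)) λ S →
      Σ Bool (λ col → ∀ (x : Elts S) → c (proj₁ x) ≡ col) ×
      (Induced M S ≅ M) ×
      IsElementarySub M S

Transitive : {L : Language} → Structure L → Set
Transitive M = ∀ (a b : Carrier M) → Σ (Aut M) λ σ → to σ a ≡ b

_≤card_ : Set → Set → Set
X ≤card Y = Σ (X → Y) (λ f → Injective _≡_ _≡_ f)

_<card_ : Set → Set → Set
X <card Y = (X ≤card Y) × ¬ (Y ≤card X)

PartialElementary : {L : Language} (M : Structure L) (A : Subset (Carrier M)) →
                    (Elts A → Carrier M) → Set
PartialElementary M A f =
  ∀ (n : ℕ) (φ : Formula _ n) (b : Fin n → Elts A) →
    (M ⊨ φ [ proj₁ ∘ b ]) ⇔ (M ⊨ φ [ f ∘ b ])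

Homogeneous : {L : Language} → Structure L → Set
Homogeneous M =
  ∀ (A : Subset (Carrier M)) → Elts A <card Carrier M →
  ∀ (f : Elts A → Carrier M) → PartialElementary M A f →
    Σ (Aut M) λ σ → ∀ (x : Elts A) → to σ (proj₁ x) ≡ f x

module Submission where

-- The witness is the equivalence relation 𝕄 with countably many classes of size
-- continuum (indexed inj₁ k, with points in D = List Bool → Bool) and countably many
-- countable classes (indexed inj₂ k, with points in ℕ).
--
-- * Back and forth: any two "equivalence models" (equivalence relations with infinitely
--   many classes, all infinite) give the same truth value to tuples with the same
--   equalities and adjacencies.  Hence a substructure that is itself an equivalence model
--   is elementary.
-- * Indivisibility: given a colouring, a Ramsey argument (using D × D ↪ D) finds a
--   monochromatic copy of D inside each uncountable class, and infinite pigeonhole finds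
--   infinitely many of these copies of one colour.  Mapping every class of 𝕄 injectively
--   into one of them yields a monochromatic self-embedding; its image is isomorphic to 𝕄,
--   hence an equivalence model, hence elementary.
-- * An automorphism would map classes onto classes; as D does not inject into ℕ, none
--   maps the countable class of a₀ onto the uncountable class of b₀.  So 𝕄 is not
--   transitive, and the elementary map a₀ ↦ b₀ on the singleton {a₀} does not extend, so
--   𝕄 is not homogeneous.

open import Defs
open import Level using (0ℓ)
open import Axiom.ExcludedMiddle using (ExcludedMiddle)
open import Data.Nat using (ℕ; zero; suc; _+_; _≤_; _<_; s≤s; _⊔_; _≡ᵇ_)
open import Data.Nat.Properties
  using (≤-trans; <-trans; m≤m+n; m≤n+m; m≤m⊔n; m≤n⊔m; 1+n≰n; suc-injective;
         <-cmp; <⇒≢; m≤n⇒m<n∨m≡n; ≡ᵇ⇒≡; ≡⇒≡ᵇ)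
open import Data.Fin using (Fin; zero; suc; toℕ)
open import Data.Bool using (Bool; true; false; T; not)
open import Data.Bool.Properties using (T-irrelevant; not-¬; ¬-not)
open import Data.Unit using (⊤; tt)
open import Data.Empty using (⊥; ⊥-elim)
open import Data.Sum using (_⊎_; inj₁; inj₂; [_,_])
open import Data.Sum.Properties using (inj₁-injective)
open import Data.Product using (Σ; _×_; _,_; proj₁; proj₂)
open import Data.List using (List; []; _∷_; length; replicate)
open import Data.List.Properties using (length-replicate)
open import Data.Vec.Functional using () renaming ([] to []ᵥ; _∷_ to _∷ᵥ_)
open import Function using (_∘_; id; _∋_)
open import Function.Bundles using (_⇔_; mk⇔; Equivalence)
open import Function.Definitions using (Injective)
open import Function.Properties.Equivalence using ()
  renaming (refl to ⇔-refl; sym to ⇔-sym; trans to ⇔-trans)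
open import Relation.Binary using (tri<; tri≈; tri>)
open import Relation.Binary.PropositionalEquality
  using (_≡_; _≢_; refl; sym; trans; cong; subst; module ≡-Reasoning)
open import Relation.Nullary using (¬_; Dec; yes; no)
open import Relation.Nullary.Decidable using (isYes; toWitness; fromWitness)

open Equivalence using () renaming (to to ⇒; from to ⇐)

EM : Set₁
EM = ExcludedMiddle 0ℓ

somewhereTrue : EM → {A : Set} (p : A → Bool) →
                ¬ (∀ x → p x ≡ false) → Σ A λ x → p x ≡ true
somewhereTrue em {A} p notAllFalse with em {Σ A λ x → p x ≡ true}
... | yes found = found
... | no none   = ⊥-elim (notAllFalse λ x → ¬-not λ px → none (x , px))

Infinite : Set → Set
Infinite A = ∀ n (u : Fin n → A) → Σ A λ a → ∀ i → a ≢ u i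

bound : ∀ {n} → (Fin n → ℕ) → ℕ
bound {zero}  u = 0
bound {suc n} u = u zero ⊔ bound (u ∘ suc)

bound-≥ : ∀ {n} (u : Fin n → ℕ) i → u i ≤ bound u
bound-≥ u zero    = m≤m⊔n _ _
bound-≥ u (suc i) = ≤-trans (bound-≥ (u ∘ suc) i) (m≤n⊔m _ _)

-- A type with a section s of a "size" map to ℕ is infinite: take an element of size
-- beyond all sizes in the family.
infinite-by-size : {A : Set} (size : A → ℕ) (s : ℕ → A) →
                   (∀ k → size (s k) ≡ k) → Infinite A
infinite-by-size size s size∘s n u = s (suc B) , λ i e →
  1+n≰n (subst (_≤ B) (trans (sym (cong size e)) (size∘s (suc B))) (bound-≥ (size ∘ u) i))
  where
  B : ℕ
  B = bound (size ∘ u)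

ℕ-infinite : Infinite ℕ
ℕ-infinite = infinite-by-size id id (λ _ → refl)

-- The sets of lists of booleans: a type of size continuum.
D : Set
D = List Bool → Bool

diagonal : (ℕ → D) → D
diagonal g l = not (g (length l) l)

cantor : (g : ℕ → D) → ∀ k → diagonal g ≢ g k
cantor g k diag≡gk = not-¬ refl (trans (sym (cong (λ d → d w) diag≡gk)) diag-at-w)
  where
  w : List Bool
  w = replicate k true
  diag-at-w : diagonal g w ≡ not (g k w)
  diag-at-w = cong (λ m → not (g m w)) (length-replicate k)

extend : {A : Set} → A → ∀ {n} → (Fin n → A) → ℕ → A
extend a {zero}  u k       = a
extend a {suc n} u zero    = u zero
extend a {suc n} u (suc k) = extend a (u ∘ suc) k

extend-toℕ : {A : Set} (a : A) {n : ℕ} (u : Fin n → A) (i : Fin n) → extend a u (toℕ i) ≡ u i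
extend-toℕ a u zero    = refl
extend-toℕ a u (suc i) = extend-toℕ a (u ∘ suc) i

D-infinite : Infinite D
D-infinite n u = diagonal g , λ i e → cantor g (toℕ i) (trans e (sym (extend-toℕ _ u i)))
  where
  g : ℕ → D
  g = extend (λ _ → false) u

leftInverse : EM → {A : Set} → A → (F : A → ℕ) → Injective _≡_ _≡_ F →
              Σ (ℕ → A) λ g → ∀ a → g (F a) ≡ a
leftInverse em {A} a₀ F F-injective = (λ n → choose n em) , λ a → choose-F a em
  where
  choose : ∀ n → Dec (Σ A λ a → F a ≡ n) → A
  choose n (yes (a , _)) = a
  choose n (no _)        = a₀
  choose-F : ∀ a (d : Dec (Σ A λ a' → F a' ≡ F a)) → choose (F a) d ≡ a
  choose-F a (yes (a' , Fa'≡Fa)) = F-injective Fa'≡Fa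
  choose-F a (no none)           = ⊥-elim (none (a , refl))

-- D is uncountable: an injection into ℕ would give a sequence hitting every element.
D-uncountable : EM → ¬ (D ≤card ℕ)
D-uncountable em (F , F-injective) = cantor g (F (diagonal g)) (sym (g∘F (diagonal g)))
  where
  g : ℕ → D
  g = proj₁ (leftInverse em (λ _ → false) F F-injective)
  g∘F : ∀ d → g (F d) ≡ d
  g∘F = proj₂ (leftInverse em (λ _ → false) F F-injective)

lengthIs : ℕ → D
lengthIs k l = length l ≡ᵇ k

lengthIs-injective : Injective _≡_ _≡_ lengthIs
lengthIs-injective {k} {k'} e =
  trans (sym (length-replicate k)) (≡ᵇ⇒≡ _ k' (subst T (cong (λ d → d w) e) at-w))
  where
  w = replicate k true
  at-w : T (lengthIs k w)
  at-w = ≡⇒≡ᵇ _ k (length-replicate k)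

MonochromaticCopy : {A : Set} → (A → Bool) → Set
MonochromaticCopy {A} c =
  Σ Bool λ col → Σ (A → A) λ e → Injective _≡_ _≡_ e × (∀ a → c (e a) ≡ col)

-- If A × A embeds into A, every 2-colouring of A has a monochromatic copy of A: either
-- some row {pair a b | b : A} is entirely false, or every row a has a true entry pair a (g a).
ramsey : EM → {A : Set} (pair : A → A → A) →
         (∀ {a b a' b'} → pair a b ≡ pair a' b' → a ≡ a' × b ≡ b') →
         (c : A → Bool) → MonochromaticCopy c
ramsey em {A} pair pair-injective c with em {Σ A λ a → ∀ b → c (pair a b) ≡ false}
... | yes (a , rowFalse) = false , pair a , proj₂ ∘ pair-injective , rowFalse
... | no noFalseRow      =
  true , (λ a → pair a (g a)) , proj₁ ∘ pair-injective , λ a → proj₂ (trueEntry a)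
  where
  trueEntry : ∀ a → Σ A λ b → c (pair a b) ≡ true
  trueEntry a = somewhereTrue em (c ∘ pair a) λ rowFalse → noFalseRow (a , rowFalse)
  g : A → A
  g = proj₁ ∘ trueEntry

-- D × D ↪ D: split a set of lists according to the head.
pairD : D → D → D
pairD d d' []          = false
pairD d d' (false ∷ l) = d l
pairD d d' (true ∷ l)  = d' l

pairD-injective : ∀ {a b a' b'} → pairD a b ≡ pairD a' b' → a ≡ a' × b ≡ b'
pairD-injective e = cong (λ p l → p (false ∷ l)) e , cong (λ p l → p (true ∷ l)) e

recurrentColour : EM → (p : ℕ → Bool) →
                  Σ Bool λ col → ∀ n → Σ ℕ λ j → n ≤ j × p j ≡ col
recurrentColour em p with em {Σ ℕ λ n → ∀ j → n ≤ j → p j ≡ false}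
... | yes (n , eventuallyFalse) =
  false , λ m → m + n , m≤m+n m n , eventuallyFalse (m + n) (m≤n+m n m)
... | no notEventuallyFalse = true , trueAfter
  where
  trueAfter : ∀ n → Σ ℕ λ j → n ≤ j × p j ≡ true
  trueAfter n =
    let ((j , n≤j) , pj) = somewhereTrue em (p ∘ proj₁ {B = n ≤_}) λ allFalse →
                             notEventuallyFalse (n , λ j n≤j → allFalse (j , n≤j))
    in j , n≤j , pj

increasing-mono : (s : ℕ → ℕ) → (∀ k → s k < s (suc k)) → ∀ {k m} → k < m → s k < s m
increasing-mono s step {k} {suc m} (s≤s k≤m) with m≤n⇒m<n∨m≡n k≤m
... | inj₁ k<m  = <-trans (increasing-mono s step k<m) (step m)
... | inj₂ refl = step k

increasing-injective : (s : ℕ → ℕ) → (∀ k → s k < s (suc k)) → Injective _≡_ _≡_ s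
increasing-injective s step {k} {m} sk≡sm with <-cmp k m
... | tri< k<m _ _ = ⊥-elim (<⇒≢ (increasing-mono s step k<m) sk≡sm)
... | tri≈ _ k≡m _ = k≡m
... | tri> _ _ m<k = ⊥-elim (<⇒≢ (increasing-mono s step m<k) (sym sk≡sm))

module Enumerate {P : ℕ → Set} (next : ∀ n → Σ ℕ λ j → n ≤ j × P j) where

  enum : ℕ → ℕ
  enum zero    = proj₁ (next 0)
  enum (suc k) = proj₁ (next (suc (enum k)))

  enum-P : ∀ k → P (enum k)
  enum-P zero    = proj₂ (proj₂ (next 0))
  enum-P (suc k) = proj₂ (proj₂ (next (suc (enum k))))

  enum-injective : Injective _≡_ _≡_ enum
  enum-injective = increasing-injective enum λ k → proj₁ (proj₂ (next (suc (enum k))))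

double : ℕ → ℕ
double zero    = zero
double (suc k) = suc (suc (double k))

double-injective : Injective _≡_ _≡_ double
double-injective {zero}  {zero}   _ = refl
double-injective {suc k} {suc k'} e = cong suc (double-injective (suc-injective (suc-injective e)))

even≢odd : ∀ k k' → double k ≢ suc (double k')
even≢odd (suc k) (suc k') e = even≢odd k k' (suc-injective (suc-injective e))

code : ℕ ⊎ ℕ → ℕ
code (inj₁ k) = double k
code (inj₂ k) = suc (double k)

code-injective : Injective _≡_ _≡_ code
code-injective {inj₁ k} {inj₁ k'} e = cong inj₁ (double-injective e)
code-injective {inj₁ k} {inj₂ k'} e = ⊥-elim (even≢odd k k' e)
code-injective {inj₂ k} {inj₁ k'} e = ⊥-elim (even≢odd k' k (sym e))
code-injective {inj₂ k} {inj₂ k'} e = cong inj₂ (double-injective (suc-injective e))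

Graph : Language
Graph = record { Sym = ⊤ ; arity = λ _ → 2 }

Adj : (N : Structure Graph) → Carrier N → Carrier N → Set
Adj N x y = rel N tt (x ∷ᵥ y ∷ᵥ []ᵥ)

-- Equivalence relations with infinitely many classes, all of them infinite.  The field
-- rel-pair says that the relation only looks at the two entries of a tuple.
record EquivalenceModel (N : Structure Graph) : Set where
  field
    rel-pair  : ∀ u → rel N tt u ⇔ Adj N (u zero) (u (suc zero))
    adj-refl  : ∀ x → Adj N x x
    adj-sym   : ∀ {x y} → Adj N x y → Adj N y x
    adj-trans : ∀ {x y z} → Adj N x y → Adj N y z → Adj N x z
    classes-infinite :
      ∀ n (u : Fin n → Carrier N) x → Σ (Carrier N) λ y → Adj N x y × (∀ i → y ≢ u i)
    infinitely-many-classes :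
      ∀ n (u : Fin n → Carrier N) → Σ (Carrier N) λ y → ∀ i → ¬ Adj N y (u i)
open EquivalenceModel

Agree : (N M : Structure Graph) {n : ℕ} → (Fin n → Carrier N) → (Fin n → Carrier M) → Set
Agree N M v w =
  ∀ i j → (v i ≡ v j ⇔ w i ≡ w j) × (Adj N (v i) (v j) ⇔ Adj M (w i) (w j))

agree-sym : {N M : Structure Graph} {n : ℕ} {v : Fin n → Carrier N} {w : Fin n → Carrier M} →
            Agree N M v w → Agree M N w v
agree-sym ag i j = ⇔-sym (proj₁ (ag i j)) , ⇔-sym (proj₂ (ag i j))

swap⇔ : {A : Set} {R : A → A → Set} → (∀ {x y} → R x y → R y x) → ∀ x y → R x y ⇔ R y x
swap⇔ r-sym x y = mk⇔ r-sym r-sym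

agree-cons : {N M : Structure Graph} → EquivalenceModel N → EquivalenceModel M →
             {n : ℕ} {v : Fin n → Carrier N} {w : Fin n → Carrier M} → Agree N M v w →
             (a : Carrier N) (b : Carrier M) →
             (∀ j → (a ≡ v j ⇔ b ≡ w j) × (Adj N a (v j) ⇔ Adj M b (w j))) →
             Agree N M (a ∷ᵥ v) (b ∷ᵥ w)
agree-cons 𝒩 ℳ ag a b new zero zero =
  mk⇔ (λ _ → refl) (λ _ → refl) , mk⇔ (λ _ → adj-refl ℳ b) (λ _ → adj-refl 𝒩 a)
agree-cons 𝒩 ℳ ag a b new zero (suc j) = new j
agree-cons 𝒩 ℳ {v = v} {w} ag a b new (suc i) zero =
  ⇔-trans (swap⇔ sym (v i) a) (⇔-trans (proj₁ (new i)) (swap⇔ sym b (w i))) ,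
  ⇔-trans (swap⇔ (adj-sym 𝒩) (v i) a) (⇔-trans (proj₂ (new i)) (swap⇔ (adj-sym ℳ) b (w i)))
agree-cons 𝒩 ℳ ag a b new (suc i) (suc j) = ag i j

-- Either a is some v i (take w i), or a lies in the class of some v i (take a
-- fresh element of the class of w i), or a lies in a new class (take b in a new class).
forth : EM → {N M : Structure Graph} → EquivalenceModel N → EquivalenceModel M →
        {n : ℕ} {v : Fin n → Carrier N} {w : Fin n → Carrier M} → Agree N M v w →
        (a : Carrier N) → Σ (Carrier M) λ b → Agree N M (a ∷ᵥ v) (b ∷ᵥ w)
forth em {N} {M} 𝒩 ℳ {n} {v} {w} ag a with em {Σ (Fin n) λ i → a ≡ v i}
... | yes (i , refl) = w i , agree-cons 𝒩 ℳ ag a (w i) (ag i)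
... | no a-new with em {Σ (Fin n) λ i → Adj N a (v i)}
...   | yes (i , a~vi) = b , agree-cons 𝒩 ℳ ag a b sameClass
  where
  fresh : Σ (Carrier M) λ b → Adj M (w i) b × (∀ j → b ≢ w j)
  fresh = classes-infinite ℳ n w (w i)
  b : Carrier M
  b = proj₁ fresh
  wi~b : Adj M (w i) b
  wi~b = proj₁ (proj₂ fresh)
  sameClass : ∀ j → (a ≡ v j ⇔ b ≡ w j) × (Adj N a (v j) ⇔ Adj M b (w j))
  sameClass j =
    mk⇔ (λ a≡vj → ⊥-elim (a-new (j , a≡vj))) (λ b≡wj → ⊥-elim (proj₂ (proj₂ fresh) j b≡wj)) ,
    mk⇔ (λ a~vj → adj-trans ℳ (adj-sym ℳ wi~b)
                    (⇒ (proj₂ (ag i j)) (adj-trans 𝒩 (adj-sym 𝒩 a~vi) a~vj)))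
        (λ b~wj → adj-trans 𝒩 a~vi (⇐ (proj₂ (ag i j)) (adj-trans ℳ wi~b b~wj)))
...   | no a-newClass = b , agree-cons 𝒩 ℳ ag a b newClass
  where
  fresh : Σ (Carrier M) λ b → ∀ j → ¬ Adj M b (w j)
  fresh = infinitely-many-classes ℳ n w
  b : Carrier M
  b = proj₁ fresh
  b≁w : ∀ j → ¬ Adj M b (w j)
  b≁w = proj₂ fresh
  newClass : ∀ j → (a ≡ v j ⇔ b ≡ w j) × (Adj N a (v j) ⇔ Adj M b (w j))
  newClass j =
    mk⇔ (λ a≡vj → ⊥-elim (a-newClass (j , subst (Adj N a) a≡vj (adj-refl 𝒩 a))))
        (λ b≡wj → ⊥-elim (b≁w j (subst (Adj M b) b≡wj (adj-refl ℳ b)))) ,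
    mk⇔ (λ a~vj → ⊥-elim (a-newClass (j , a~vj))) (λ b~wj → ⊥-elim (b≁w j b~wj))

transfer : EM → {N M : Structure Graph} → EquivalenceModel N → EquivalenceModel M →
           {n : ℕ} (φ : Formula Graph n) {v : Fin n → Carrier N} {w : Fin n → Carrier M} →
           Agree N M v w → (N ⊨ φ [ v ]) ⇔ (M ⊨ φ [ w ])
transfer em 𝒩 ℳ (atom tt f) {v} {w} ag =
  ⇔-trans (rel-pair 𝒩 (v ∘ f))
    (⇔-trans (proj₂ (ag (f zero) (f (suc zero)))) (⇔-sym (rel-pair ℳ (w ∘ f))))
transfer em 𝒩 ℳ (eq i j) ag = proj₁ (ag i j)
transfer em 𝒩 ℳ ff ag = ⇔-refl
transfer em {N} {M} 𝒩 ℳ (φ ⇒ ψ) {v} {w} ag =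
  mk⇔ (λ φ→ψ φw → ⇒ ψ-transfer (φ→ψ (⇐ φ-transfer φw)))
      (λ φ→ψ φv → ⇐ ψ-transfer (φ→ψ (⇒ φ-transfer φv)))
  where
  φ-transfer : (N ⊨ φ [ v ]) ⇔ (M ⊨ φ [ w ])
  φ-transfer = transfer em 𝒩 ℳ φ ag
  ψ-transfer : (N ⊨ ψ [ v ]) ⇔ (M ⊨ ψ [ w ])
  ψ-transfer = transfer em 𝒩 ℳ ψ ag
transfer em {N} {M} 𝒩 ℳ (all φ) {v} {w} ag = mk⇔ there back
  where
  there : (∀ a → N ⊨ φ [ a ∷ᵥ v ]) → ∀ b → M ⊨ φ [ b ∷ᵥ w ]
  there ∀φ b = let (a , ag′) = forth em ℳ 𝒩 (agree-sym {N} {M} ag) b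
               in ⇒ (transfer em 𝒩 ℳ φ (agree-sym {M} {N} ag′)) (∀φ a)
  back : (∀ b → M ⊨ φ [ b ∷ᵥ w ]) → ∀ a → N ⊨ φ [ a ∷ᵥ v ]
  back ∀φ a = let (b , ag′) = forth em 𝒩 ℳ ag a
              in ⇐ (transfer em 𝒩 ℳ φ ag′) (∀φ b)

adj-≅ : {N M : Structure Graph} → EquivalenceModel M → (ι : N ≅ M) →
        ∀ x y → Adj N x y ⇔ Adj M (to ι x) (to ι y)
adj-≅ ℳ ι x y = ⇔-trans (preserves ι tt (x ∷ᵥ y ∷ᵥ []ᵥ)) (rel-pair ℳ _)

model-≅ : {N M : Structure Graph} → N ≅ M → EquivalenceModel M → EquivalenceModel N
model-≅ {N} {M} ι ℳ = record
  { rel-pair  = λ u → ⇔-trans (preserves ι tt u)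
                  (⇔-trans (rel-pair ℳ (to ι ∘ u)) (⇔-sym (adj-≅ ℳ ι (u zero) (u (suc zero)))))
  ; adj-refl  = λ x → ⇐ (adj-≅ ℳ ι x x) (adj-refl ℳ (to ι x))
  ; adj-sym   = λ {x} {y} x~y → ⇐ (adj-≅ ℳ ι y x) (adj-sym ℳ (⇒ (adj-≅ ℳ ι x y) x~y))
  ; adj-trans = λ {x} {y} {z} x~y y~z → ⇐ (adj-≅ ℳ ι x z)
                  (adj-trans ℳ (⇒ (adj-≅ ℳ ι x y) x~y) (⇒ (adj-≅ ℳ ι y z) y~z))
  ; classes-infinite = classes-infinite-N
  ; infinitely-many-classes = infinitely-many-classes-N
  }
  where
  classes-infinite-N : ∀ n (u : Fin n → Carrier N) x →
                       Σ (Carrier N) λ y → Adj N x y × (∀ i → y ≢ u i)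
  classes-infinite-N n u x =
    let (y , x~y , y-fresh) = classes-infinite ℳ n (to ι ∘ u) (to ι x)
    in from ι y ,
       ⇐ (adj-≅ ℳ ι x (from ι y)) (subst (Adj M (to ι x)) (sym (to∘from ι y)) x~y) ,
       λ i e → y-fresh i (trans (sym (to∘from ι y)) (cong (to ι) e))
  infinitely-many-classes-N : ∀ n (u : Fin n → Carrier N) →
                              Σ (Carrier N) λ y → ∀ i → ¬ Adj N y (u i)
  infinitely-many-classes-N n u =
    let (y , y-apart) = infinitely-many-classes ℳ n (to ι ∘ u)
    in from ι y , λ i y~ui →
         y-apart i (subst (λ z → Adj M z (to ι (u i))) (to∘from ι y) (⇒ (adj-≅ ℳ ι _ _) y~ui))

Elts-≡ : {A : Set} {S : Subset A} {x y : Elts S} → proj₁ x ≡ proj₁ y → x ≡ y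
Elts-≡ {x = a , p} {.a , q} refl = cong (a ,_) (T-irrelevant p q)

-- A substructure of an equivalence model which is itself an equivalence model is
-- elementary: a tuple of the substructure agrees with its image.
elementary-of-models : EM → {M : Structure Graph} {S : Subset (Carrier M)} →
                       EquivalenceModel M → EquivalenceModel (Induced M S) →
                       IsElementarySub M S
elementary-of-models em {M} {S} ℳ 𝒮 n φ v = transfer em 𝒮 ℳ φ agreement
  where
  agreement : Agree (Induced M S) M v (proj₁ ∘ v)
  agreement i j = mk⇔ (cong proj₁) Elts-≡ , rel-pair ℳ (proj₁ ∘ (v i ∷ᵥ v j ∷ᵥ []ᵥ))

record Embedding {L : Language} (M N : Structure L) : Set where
  field
    embed           : Carrier M → Carrier N
    embed-injective : Injective _≡_ _≡_ embed
    embed-rel       : ∀ R v → rel N R (embed ∘ v) ⇔ rel M R v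
open Embedding

Extensional : {L : Language} → Structure L → Set
Extensional N = ∀ R {u u′} → (∀ i → u i ≡ u′ i) → rel N R u → rel N R u′

image : EM → {A B : Set} → (A → B) → Subset B
image em {A} h b = isYes (em {Σ A λ a → h a ≡ b})

preimage : (em : EM) {A B : Set} (h : A → B) {b : B} →
           T (image em h b) → Σ A λ a → h a ≡ b
preimage em h = toWitness {a? = em}

image-≅ : (em : EM) {L : Language} {M N : Structure L} → Extensional N →
          (e : Embedding M N) → Induced N (image em (embed e)) ≅ M
image-≅ em N-ext e = record
  { to        = λ y → proj₁ (preimage em (embed e) (proj₂ y))
  ; from      = λ x → embed e x , fromWitness (x , refl)
  ; from∘to   = λ y → Elts-≡ (proj₂ (preimage em (embed e) (proj₂ y)))
  ; to∘from   = λ x → embed-injective e (proj₂ (preimage em (embed e) (fromWitness (x , refl))))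
  ; preserves = λ R v → ⇔-trans (mk⇔ (N-ext R (on-image v)) (N-ext R (sym ∘ on-image v)))
                          (embed-rel e R _)
  }
  where
  on-image : ∀ {n} (v : Fin n → Elts (image em (embed e))) i →
             proj₁ (v i) ≡ embed e (proj₁ (preimage em (embed e) (proj₂ (v i))))
  on-image v i = sym (proj₂ (preimage em (embed e) (proj₂ (v i))))

MonochromaticEmbedding : {L : Language} (M : Structure L) → (Carrier M → Bool) → Set
MonochromaticEmbedding M c = Σ Bool λ col → Σ (Embedding M M) λ e → ∀ x → c (embed e x) ≡ col

-- An extensional equivalence model with monochromatic self-embeddings for all colourings
-- is elementarily indivisible: the image of such an embedding is a monochromatic copy,
-- isomorphic to the model, hence an equivalence model, hence elementary.
indivisible : EM → {M : Structure Graph} → EquivalenceModel M → Extensional M →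
              (∀ c → MonochromaticEmbedding M c) → ElementarilyIndivisible M
indivisible em {M} ℳ M-ext monochromatic c =
  image em (embed e) , (col , monochrome) , copy , elementary-of-models em ℳ (model-≅ copy ℳ)
  where
  col : Bool
  col = proj₁ (monochromatic c)
  e : Embedding M M
  e = proj₁ (proj₂ (monochromatic c))
  copy : Induced M (image em (embed e)) ≅ M
  copy = image-≅ em M-ext e
  monochrome : ∀ (y : Elts (image em (embed e))) → c (proj₁ y) ≡ col
  monochrome (y , p) = subst (λ z → c z ≡ col) (proj₂ (preimage em (embed e) p))
                         (proj₂ (proj₂ (monochromatic c)) _)

Classes : (I : Set) → (I → Set) → Structure Graph
Classes I X = record { Carrier = Σ I X ; rel = λ _ u → proj₁ (u zero) ≡ proj₁ (u (suc zero)) }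

classes-extensional : {I : Set} {X : I → Set} → Extensional (Classes I X)
classes-extensional _ u≗u′ same =
  trans (sym (cong proj₁ (u≗u′ zero))) (trans same (cong proj₁ (u≗u′ (suc zero))))

-- With infinitely many classes, each infinite, a class structure is an equivalence model.
-- The retractions r i (onto class i) turn a family of points into a family in X i.
classes-model : {I : Set} {X : I → Set} → Infinite I → (∀ i → Infinite (X i)) →
                (r : ∀ i → Σ I X → X i) → (∀ i x → r i (i , x) ≡ x) →
                EquivalenceModel (Classes I X)
classes-model {I} {X} I-infinite X-infinite r r-retract = record
  { rel-pair  = λ _ → ⇔-refl
  ; adj-refl  = λ _ → refl
  ; adj-sym   = sym
  ; adj-trans = trans
  ; classes-infinite = classes-infinite-I
  ; infinitely-many-classes = infinitely-many-classes-I
  }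
  where
  classes-infinite-I : ∀ n (u : Fin n → Σ I X) x →
                       Σ (Σ I X) λ y → proj₁ x ≡ proj₁ y × (∀ j → y ≢ u j)
  classes-infinite-I n u (i , _) =
    let (x′ , x′-fresh) = X-infinite i n (r i ∘ u)
    in (i , x′) , refl , λ j e → x′-fresh j (trans (sym (r-retract i x′)) (cong (r i) e))
  infinitely-many-classes-I : ∀ n (u : Fin n → Σ I X) →
                              Σ (Σ I X) λ y → ∀ j → proj₁ y ≢ proj₁ (u j)
  infinitely-many-classes-I n u =
    let (i′ , i′-fresh) = I-infinite n (proj₁ ∘ u)
    in (i′ , proj₁ (X-infinite i′ 0 λ ())) , i′-fresh

classEmbedding : {I : Set} {X : I → Set} (f : I → I) → Injective _≡_ _≡_ f →
                 (g : ∀ i → X i → X (f i)) → (∀ i → Injective _≡_ _≡_ (g i)) →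
                 Embedding (Classes I X) (Classes I X)
classEmbedding {I} {X} f f-injective g g-injective = record
  { embed           = λ (i , x) → f i , g i x
  ; embed-injective = injective
  ; embed-rel       = λ _ _ → mk⇔ f-injective (cong f)
  }
  where
  second : ∀ {i} {x y : X i} → (Σ I X ∋ (i , x)) ≡ (i , y) → x ≡ y
  second refl = refl
  injective : ∀ {p q : Σ I X} → (f (proj₁ p) , g _ (proj₂ p)) ≡ (f (proj₁ q) , g _ (proj₂ q)) → p ≡ q
  injective {i , x} {j , y} e with f-injective (cong proj₁ e)
  ... | refl = cong (i ,_) (g-injective i (second e))

Index : Set
Index = ℕ ⊎ ℕ

Content : Index → Set
Content (inj₁ _) = D
Content (inj₂ _) = ℕ

𝕄 : Structure Graph
𝕄 = Classes Index Content

Point : Set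
Point = Carrier 𝕄

-- The content of a point seen in class i (a default value if the point is elsewhere).
contentIn : (i : Index) → Point → Content i
contentIn (inj₁ _) (inj₁ _ , d) = d
contentIn (inj₁ _) (inj₂ _ , _) = λ _ → false
contentIn (inj₂ _) (inj₁ _ , _) = 0
contentIn (inj₂ _) (inj₂ _ , m) = m

contentIn-retract : ∀ i x → contentIn i (i , x) ≡ x
contentIn-retract (inj₁ _) _ = refl
contentIn-retract (inj₂ _) _ = refl

content-infinite : ∀ i → Infinite (Content i)
content-infinite (inj₁ _) = D-infinite
content-infinite (inj₂ _) = ℕ-infinite

𝕄-model : EquivalenceModel 𝕄
𝕄-model = classes-model (infinite-by-size [ id , id ] inj₁ λ _ → refl)
                        content-infinite contentIn contentIn-retract

intoD : (i : Index) → Content i → D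
intoD (inj₁ _) = id
intoD (inj₂ _) = lengthIs

intoD-injective : ∀ i → Injective _≡_ _≡_ (intoD i)
intoD-injective (inj₁ _) = id
intoD-injective (inj₂ _) = lengthIs-injective

-- Monochromatic self-embeddings of 𝕄: inside each class inj₁ j pick a monochromatic copy
-- of D, choose injectively infinitely many classes J k whose copies share the colour col,
-- and send class i onto the copy inside class inj₁ (J (code i)).
monochromaticEmbedding : EM → (c : Point → Bool) → MonochromaticEmbedding 𝕄 c
monochromaticEmbedding em c = col , classEmbedding f f-injective g g-injective , g-colour
  where
  copy : ∀ j → MonochromaticCopy (λ d → c (inj₁ j , d))
  copy j = ramsey em pairD pairD-injective (λ d → c (inj₁ j , d))
  col : Bool
  col = proj₁ (recurrentColour em (proj₁ ∘ copy))
  open Enumerate (proj₂ (recurrentColour em (proj₁ ∘ copy)))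
  J : Index → ℕ
  J i = enum (code i)
  f : Index → Index
  f i = inj₁ (J i)
  f-injective : Injective _≡_ _≡_ f
  f-injective e = code-injective (enum-injective (inj₁-injective e))
  g : ∀ i → Content i → D
  g i = proj₁ (proj₂ (copy (J i))) ∘ intoD i
  g-injective : ∀ i → Injective _≡_ _≡_ (g i)
  g-injective i = intoD-injective i ∘ proj₁ (proj₂ (proj₂ (copy (J i))))
  g-colour : ∀ p → c (f (proj₁ p) , g (proj₁ p) (proj₂ p)) ≡ col
  g-colour (i , x) = trans (proj₂ (proj₂ (proj₂ (copy (J i)))) (intoD i x)) (enum-P (code i))

aut-class : {I : Set} {X : I → Set} (σ : Aut (Classes I X)) (a y : Σ I X) →
            proj₁ y ≡ proj₁ (to σ a) → proj₁ (from σ y) ≡ proj₁ a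
aut-class σ a y y~σa =
  ⇐ (preserves σ tt (from σ y ∷ᵥ a ∷ᵥ []ᵥ)) (trans (cong proj₁ (to∘from σ y)) y~σa)

a₀ b₀ : Point
a₀ = inj₂ 0 , 0
b₀ = inj₁ 0 , λ _ → false

-- No automorphism maps the countable class of a₀ onto the uncountable class of b₀:
-- σ⁻¹ would inject the class of b₀, hence D, into the class of a₀, hence ℕ.
noAutomorphism : EM → (σ : Aut 𝕄) → to σ a₀ ≡ b₀ → ⊥
noAutomorphism em σ σa₀≡b₀ = D-uncountable em (F , F-injective)
  where
  in-class-of-a₀ : ∀ d → proj₁ (from σ (inj₁ 0 , d)) ≡ inj₂ 0
  in-class-of-a₀ d = aut-class σ a₀ (inj₁ 0 , d) (cong proj₁ (sym σa₀≡b₀))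
  same-content : ∀ {x y : Point} → proj₁ x ≡ inj₂ 0 → proj₁ y ≡ inj₂ 0 →
                 contentIn (inj₂ 0) x ≡ contentIn (inj₂ 0) y → x ≡ y
  same-content {_ , m} {_ , .m} refl refl refl = refl
  F : D → ℕ
  F d = contentIn (inj₂ 0) (from σ (inj₁ 0 , d))
  F-injective : Injective _≡_ _≡_ F
  F-injective {d} {d′} e =
    cong (contentIn (inj₁ 0)) (begin
      (inj₁ 0 , d)                   ≡⟨ to∘from σ _ ⟨
      to σ (from σ (inj₁ 0 , d))     ≡⟨ cong (to σ) (same-content (in-class-of-a₀ d) (in-class-of-a₀ d′) e) ⟩
      to σ (from σ (inj₁ 0 , d′))    ≡⟨ to∘from σ _ ⟩
      (inj₁ 0 , d′)                  ∎)
    where open ≡-Reasoning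

not-transitive : EM → ¬ Transitive 𝕄
not-transitive em transitive =
  noAutomorphism em (proj₁ (transitive a₀ b₀)) (proj₂ (transitive a₀ b₀))

only-a₀ : Subset Point
only-a₀ (inj₂ zero , zero) = true
only-a₀ _                  = false

is-a₀ : (s : Elts only-a₀) → proj₁ s ≡ a₀
is-a₀ ((inj₂ zero , zero) , _)   = refl
is-a₀ ((inj₂ zero , suc _) , ())
is-a₀ ((inj₂ (suc _) , _) , ())
is-a₀ ((inj₁ _ , _) , ())

-- {a₀} is smaller than 𝕄, as 𝕄 has two distinct points.
only-a₀-small : Elts only-a₀ <card Point
only-a₀-small = (proj₁ , Elts-≡) , λ (f , f-injective) →
  a₀≢a₁ (f-injective {a₀} {a₁} (Elts-≡ {x = f a₀} {f a₁} (trans (is-a₀ (f a₀)) (sym (is-a₀ (f a₁))))))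
  where
  a₁ : Point
  a₁ = inj₂ 0 , 1
  a₀≢a₁ : a₀ ≢ a₁
  a₀≢a₁ ()

agree-constant : {N M : Structure Graph} → EquivalenceModel N → EquivalenceModel M →
                 {n : ℕ} {v : Fin n → Carrier N} {w : Fin n → Carrier M} {a : Carrier N} {b : Carrier M} →
                 (∀ i → v i ≡ a) → (∀ i → w i ≡ b) → Agree N M v w
agree-constant {N} {M} 𝒩 ℳ {v = v} {w} v≡a w≡b i j =
  mk⇔ (λ _ → w-equal) (λ _ → v-equal) ,
  mk⇔ (λ _ → subst (Adj M (w i)) w-equal (adj-refl ℳ (w i)))
      (λ _ → subst (Adj N (v i)) v-equal (adj-refl 𝒩 (v i)))
  where
  v-equal : v i ≡ v j
  v-equal = trans (v≡a i) (sym (v≡a j))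
  w-equal : w i ≡ w j
  w-equal = trans (w≡b i) (sym (w≡b j))

-- a₀ ↦ b₀ is elementary (all points have the same type) but extends to no automorphism.
not-homogeneous : EM → ¬ Homogeneous 𝕄
not-homogeneous em homogeneous = noAutomorphism em (proj₁ extension) (proj₂ extension (a₀ , tt))
  where
  a₀↦b₀-elementary : PartialElementary 𝕄 only-a₀ (λ _ → b₀)
  a₀↦b₀-elementary n φ v =
    transfer em 𝕄-model 𝕄-model φ (agree-constant 𝕄-model 𝕄-model (is-a₀ ∘ v) (λ _ → refl))
  extension : Σ (Aut 𝕄) λ σ → ∀ (x : Elts only-a₀) → to σ (proj₁ x) ≡ b₀
  extension = homogeneous only-a₀ only-a₀-small (λ _ → b₀) a₀↦b₀-elementary

corollary3p6 : ExcludedMiddle 0ℓ →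
    Σ Language λ L → Σ (Structure L) λ M →
      ElementarilyIndivisible M × ¬ Transitive M × ¬ Homogeneous M
corollary3p6 em =
  Graph , 𝕄 ,
  indivisible em 𝕄-model classes-extensional (monochromaticEmbedding em) ,
  not-transitive em ,
  not-homogeneous em
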